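{- In the theory $\mathsf{ATC}$ extended by the definition $Pxy \leftrightarrow \mathfrak{at}_{x}\preccurlyeq \mathfrak{at}_{y}$, with $Oxy:=\exists z(Pzx\land Pzy)$, the formula $\forall_{z\prec zz} Pzx \land \forall y\big(Pyx\to \exists_{z\prec zz} Ozy\big)\to F_{zz}x$ is provable.
   Context: Language: two-sorted classical logic with individual variables $x,y,z,\dots$ and plural variables $xx,yy,zz,\dots$; identity $=$ between individual terms; the predicate $x\prec tt$ ("$x$ is one of $tt$") with an individual term on the left and a plural term on the right. Abbreviations: $tt\preccurlyeq ss := \forall z(z\prec tt\to z\prec ss)\land \exists x(x\prec tt)$; $tt\approx ss := \forall x(x\prec tt\leftrightarrow x\prec ss)$; restricted quantifiers $\forall_{z\prec tt}\varphi:=\forall z(z\prec tt\to\varphi)$, $\exists_{z\prec tt}\varphi:=\exists z(z\prec tt\land\varphi)$, $\forall_{yy\preccurlyeq tt}\varphi:=\forall yy(yy\preccurlyeq tt\to\varphi)$, $\exists_{yy\preccurlyeq tt}\varphi:=\exists yy(yy\preccurlyeq tt\land\varphi)$. No plural comprehension schema is assumed and plurals may be empty. The theory $\mathsf{ATC}$ has a single non-logical primitive $F$, written $F_{tt}x$ ("$x$ is a composition of $tt$"), with $tt$ a plural term and $x$ individual. Plural terms: plural variables, a constant $aa$, and $\mathfrak{at}_{tt}$ for plural terms $tt$. Axioms of $\mathsf{ATC}$ (universally closed): (Df.$aa_F$) $x\prec aa\leftrightarrow \forall yy\,\forall_{z\prec yy}(F_{yy}x\to z=x)$; (Df.$\mathfrak{at}^{pl}_F$)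 $x\prec \mathfrak{at}_{zz}\leftrightarrow \exists_{y\prec zz}\exists_{yy\preccurlyeq aa}(F_{yy}y\land x\prec yy)$; (ATC1) $\forall x\,\exists_{zz\preccurlyeq aa}\big(F_{zz}x\land \forall_{yy\preccurlyeq aa}(F_{yy}x\leftrightarrow zz\approx yy)\land\forall y(F_{zz}y\to x=y)\big)$; (ATC2) $F_{zz}x\leftrightarrow F_{\mathfrak{at}_{zz}}x$. Since by (ATC1) each $x$ determines a unique such plurality, $\mathsf{ATC}$ is extended by a plural term $\mathfrak{at}_x$ for each individual term $x$, characterized by $\mathfrak{at}_{x}\preccurlyeq aa \land F_{\mathfrak{at}_{x}}x \land \forall_{yy\preccurlyeq aa}(F_{yy}x\leftrightarrow yy\approx\mathfrak{at}_{x})\land \forall y (F_{\mathfrak{at}_{x}}y\to x=y)$. -}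

module Defs where

open import Data.Product using (Σ; _×_; _,_)
open import Relation.Binary.PropositionalEquality using (_≡_)

_⟺_ : Set → Set → Set
A ⟺ B = (A → B) × (B → A)
infix 2 _⟺_

-- A model (two-sorted, classical semantics supplied separately) of ATC,
-- extended by the definitional plural terms 𝔞𝔱_x for individual terms x.
-- Ind : individuals, Pl : pluralities (possibly empty, no comprehension),
-- _≺_ : "is one of", F zz x : "x is a composition of zz".
record ATC : Set₁ where
  field
    Ind  : Set
    Pl   : Set
    _≺_  : Ind → Pl → Set
    F    : Pl → Ind → Set
    aa   : Pl
    atP  : Pl → Pl
    atI  : Ind → Pl

  _≼_ : Pl → Pl → Set
  tt ≼ ss = (∀ z → z ≺ tt → z ≺ ss) × Σ Ind (λ x → x ≺ tt)

  _≈_ : Pl → Pl → Set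
  tt ≈ ss = ∀ x → (x ≺ tt ⟺ x ≺ ss)

  field
    Df-aa : ∀ x → (x ≺ aa ⟺ (∀ yy z → z ≺ yy → F yy x → z ≡ x))
    Df-at : ∀ x zz →
      (x ≺ atP zz ⟺ Σ Ind (λ y → y ≺ zz × Σ Pl (λ yy → yy ≼ aa × F yy y × x ≺ yy)))
    ATC1  : ∀ x → Σ Pl (λ zz → zz ≼ aa × F zz x
              × (∀ yy → yy ≼ aa → (F yy x ⟺ zz ≈ yy))
              × (∀ y → F zz y → x ≡ y))
    ATC2  : ∀ zz x → (F zz x ⟺ F (atP zz) x)
    Df-atI : ∀ x → atI x ≼ aa × F (atI x) x
              × (∀ yy → yy ≼ aa → (F yy x ⟺ yy ≈ atI x))
              × (∀ y → F (atI x) y → x ≡ y)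

  P : Ind → Ind → Set
  P x y = atI x ≼ atI y

  O : Ind → Ind → Set
  O x y = Σ Ind (λ z → P z x × P z y)

-- Every atom below x lies in some 𝔞𝔱_z with z one of zz: the atom is a part of x,
-- so it overlaps some z, and the only atom that can witness an overlap with an atom
-- is the atom itself.  Conversely every atom of some 𝔞𝔱_z with z one of zz lies in
-- 𝔞𝔱_x because P z x.  Hence 𝔞𝔱_{zz} ≈ 𝔞𝔱_x, a nonempty plurality of atoms, so the
-- uniqueness clause for 𝔞𝔱_x gives F_{𝔞𝔱_{zz}} x, and (ATC2) gives F_{zz} x.
module Submission where

open import Defs
open import Data.Product using (Σ; _×_; _,_; proj₁; proj₂)
open import Data.Sum using (_⊎_)
open import Relation.Nullary using (¬_)
open import Relation.Binary.PropositionalEquality using (_≡_; subst; sym)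

module ATC-Properties (M : ATC) where
  open ATC M

  _⊆_ : Pl → Pl → Set
  tt ⊆ ss = ∀ z → z ≺ tt → z ≺ ss

  atI-nonempty : ∀ x → Σ Ind (λ w → w ≺ atI x)
  atI-nonempty x = proj₂ (proj₁ (Df-atI x))

  atI⊆aa : ∀ x → atI x ⊆ aa
  atI⊆aa x = proj₁ (proj₁ (Df-atI x))

  F-atI : ∀ x → F (atI x) x
  F-atI x = proj₁ (proj₂ (Df-atI x))

  ≈atI-of-F : ∀ x yy → yy ≼ aa → F yy x → yy ≈ atI x
  ≈atI-of-F x yy yy≼aa = proj₁ (proj₁ (proj₂ (proj₂ (Df-atI x))) yy yy≼aa)

  F-of-≈atI : ∀ x yy → yy ≼ aa → yy ≈ atI x → F yy x
  F-of-≈atI x yy yy≼aa = proj₂ (proj₁ (proj₂ (proj₂ (Df-atI x))) yy yy≼aa)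

  atom-atI-singleton : ∀ w v → w ≺ aa → v ≺ atI w → v ≡ w
  atom-atI-singleton w v w≺aa v≺atIw = proj₁ (Df-aa w) w≺aa (atI w) v v≺atIw (F-atI w)

  atI⊆atP : ∀ zz y → y ≺ zz → atI y ⊆ atP zz
  atI⊆atP zz y y≺zz w w≺atIy =
    proj₂ (Df-at w zz) (y , y≺zz , atI y , proj₁ (Df-atI y) , F-atI y , w≺atIy)

  atP-members : ∀ zz w → w ≺ atP zz → Σ Ind (λ y → y ≺ zz × w ≺ atI y)
  atP-members zz w w≺atP with proj₁ (Df-at w zz) w≺atP
  ... | y , y≺zz , yy , yy≼aa , Fyyy , w≺yy = y , y≺zz , proj₁ (≈atI-of-F y yy yy≼aa Fyyy w) w≺yy

  atP⊆aa : ∀ zz → atP zz ⊆ aa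
  atP⊆aa zz w w≺atP with atP-members zz w w≺atP
  ... | y , _ , w≺atIy = atI⊆aa y w w≺atIy

  P-refl : ∀ x → P x x
  P-refl x = (λ _ h → h) , atI-nonempty x

  P-of-atom : ∀ w x → w ≺ aa → w ≺ atI x → P w x
  P-of-atom w x w≺aa w≺atIx =
    (λ v v≺atIw → subst (λ t → t ≺ atI x) (sym (atom-atI-singleton w v w≺aa v≺atIw)) w≺atIx)
    , atI-nonempty w

  atom-of-O : ∀ z w → w ≺ aa → O z w → w ≺ atI z
  atom-of-O z w w≺aa (u , (atIu⊆atIz , v , v≺atIu) , (atIu⊆atIw , _)) =
    subst (λ t → t ≺ atI z) (atom-atI-singleton w v w≺aa (atIu⊆atIw v v≺atIu)) (atIu⊆atIz v v≺atIu)

  module _ (zz : Pl) (x : Ind)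
           (parts : ∀ z → z ≺ zz → P z x)
           (covers : ∀ y → P y x → Σ Ind (λ z → z ≺ zz × O z y)) where

    atP≼aa : atP zz ≼ aa
    atP≼aa with covers x (P-refl x)
    ... | z , z≺zz , _ with atI-nonempty z
    ...   | w , w≺atIz = atP⊆aa zz , w , atI⊆atP zz z z≺zz w w≺atIz

    atP≈atI : atP zz ≈ atI x
    atP≈atI w = to , from
      where
      to : w ≺ atP zz → w ≺ atI x
      to w≺atP with atP-members zz w w≺atP
      ... | y , y≺zz , w≺atIy = proj₁ (parts y y≺zz) w w≺atIy

      from : w ≺ atI x → w ≺ atP zz
      from w≺atIx with atI⊆aa x w w≺atIx
      ... | w≺aa with covers w (P-of-atom w x w≺aa w≺atIx)
      ...   | z , z≺zz , Ozw = atI⊆atP zz z z≺zz w (atom-of-O z w w≺aa Ozw)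

    F-of-parts-covering : F zz x
    F-of-parts-covering = proj₂ (ATC2 zz x) (F-of-≈atI x (atP zz) atP≼aa atP≈atI)

lemma3 : (lem : (A : Set) → A ⊎ ¬ A) → (M : ATC) → let open ATC M in
    ∀ (zz : Pl) (x : Ind) →
      (∀ z → z ≺ zz → P z x) →
      (∀ y → P y x → Σ Ind (λ z → z ≺ zz × O z y)) →
      F zz x
lemma3 _ M = ATC-Properties.F-of-parts-covering M
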